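{- Let $m \ge 2$ and $K = 2^{m-1}-m$. If $[i_1,\ldots,i_K]$ and $[i'_1,\ldots,i'_K]$ are stepping sequences for $m-1$, then $$[i_1+1,i_2+1,\ldots,i_K+1] \cup [1,2,\ldots,m-1] \cup [i'_1,i'_2,\ldots,i'_K]$$ and $$[i_1,i_2,\ldots,i_K] \cup [m-1,m-2,\ldots,1] \cup [i'_1+1,i'_2+1,\ldots,i'_K+1]$$ are stepping sequences for $m$.
   Context: For $n \ge 1$, start with the nested chain $S_0 \subset S_1 \subset \cdots \subset S_n$ where $S_i=\{1,\ldots,i\}$ (so $\#S_i=i$). A move with index $i$, $1\le i\le n-1$, replaces $S_i$ by $S_i^* = S_{i-1}\cup(S_{i+1}\setminus S_i)$ (this keeps the chain nested with $\#S_i=i$); the set produced by the move is the new value of $S_i$. A finite sequence $[i_1,\ldots,i_N]$ with entries in $\{1,\ldots,n-1\}$ is a stepping sequence for $n$ if, applying the moves $i_1,\ldots,i_N$ successively starting from this chain, the sets produced by the moves, together with the initial sets $S_0,\ldots,S_n$, contain every subset of $\{1,\ldots,n\}$ exactly once (so $N=2^n-n-1$). Here $\cup$ between sequences denotes concatenation. -}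

module Defs where

open import Data.Nat using (ℕ; zero; suc; _∸_; _≤_; _<ᵇ_; _≡ᵇ_)
open import Data.Bool using (if_then_else_)
open import Data.Fin using (toℕ)
open import Data.Fin.Subset using (Subset; _∪_; _∩_; ∁)
open import Data.Vec using (tabulate)
open import Data.List using (List; []; _∷_; _++_; applyUpTo)
open import Data.List.Relation.Unary.All using (All)
open import Data.List.Relation.Unary.Unique.Propositional using (Unique)
open import Data.List.Membership.Propositional using (_∈_)
open import Data.Product using (_×_)

-- Subsets of {1,…,n} are represented as Subset n (Vec Bool n);
-- position j : Fin n stands for the element toℕ j + 1.

-- A chain S_0 ⊂ … ⊂ S_n, indexed by ℕ (only indices 0..n are meaningful).
Chain : ℕ → Set
Chain n = ℕ → Subset n

initChain : (n : ℕ) → Chain n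
initChain n i = tabulate (λ j → toℕ j <ᵇ i)

moveSet : ∀ {n} → Chain n → ℕ → Subset n
moveSet c i = c (i ∸ 1) ∪ (c (suc i) ∩ ∁ (c i))

applyMove : ∀ {n} → Chain n → ℕ → Chain n
applyMove c i k = if k ≡ᵇ i then moveSet c i else c k

produced : ∀ {n} → Chain n → List ℕ → List (Subset n)
produced c [] = []
produced c (i ∷ is) = moveSet c i ∷ produced (applyMove c i) is

initialSets : (n : ℕ) → List (Subset n)
initialSets n = applyUpTo (initChain n) (suc n)

allSets : (n : ℕ) → List ℕ → List (Subset n)
allSets n is = initialSets n ++ produced (initChain n) is

IsStepping : ℕ → List ℕ → Set
IsStepping n is =
  All (λ i → 1 ≤ i × i ≤ n ∸ 1) is
  × Unique (allSets n is)
  × (∀ (s : Subset n) → s ∈ allSets n is)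

-- Split the subsets of {1,…,n+1} by one new element (1 for the first
-- construction, n+1 for the second): an "extension" is a bijection
-- Bool × Subset n ↔ Subset (n+1) under which moves act bitwise.  If the sets
-- of a chain avoid the new element up to index j and contain it above j
-- ("split at j"), moves below j and above j+1 simulate moves of a chain for
-- n, while the moves j+1 resp. j shift the split point up resp. down.  So each
-- construction runs the first sequence on one half, sweeps the split point
-- across, and runs the second sequence on the other half from the chain c the
-- first one reached.  Every chain reached by valid moves is a "flag", the
-- initial chain relabelled by a permutation, and relabelling commutes with
-- moves; hence a stepping sequence enumerates all subsets from any flag, and
-- the visited sets are a permutation of two tagged enumerations.
module Submission where

open import Defs
open import Data.Bool using (Bool; true; false; _∨_; _∧_; not; T)
import Data.Bool as Bool
open import Data.Bool.Properties using (∧-inverseʳ; ∨-identityʳ; not-¬; ¬-not)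
open import Data.Empty using (⊥; ⊥-elim)
open import Data.Unit using (tt)
open import Data.Fin using (Fin; toℕ; fromℕ<)
open import Data.Fin.Properties using (toℕ-injective; toℕ<n; toℕ-fromℕ<)
open import Data.Fin.Permutation using (Permutation′; permutation; _⟨$⟩ʳ_; inverseʳ; inverseˡ; flip; id; _∘ₚ_)
open import Data.Fin.Subset using (Subset; _∪_; _∩_; ∁)
open import Data.Fin.Subset.Properties using (∩-inverseʳ; ∪-identityʳ)
open import Data.List using (List; []; _∷_; [_]; map; length; _++_; applyUpTo; applyDownFrom; reverse)
open import Data.List.Properties using (map-++; map-applyUpTo; applyUpTo-∷ʳ; reverse-applyUpTo; ++-assoc)
open import Data.List.Relation.Unary.All using (All; []; _∷_) renaming (map to mapAll)
import Data.List.Relation.Unary.All.Properties as AllP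
open import Data.List.Relation.Unary.Unique.Propositional using (Unique)
import Data.List.Relation.Unary.Unique.Propositional.Properties as UniqueP
open import Data.List.Membership.Propositional using (_∈_)
open import Data.List.Membership.Propositional.Properties using (∈-map⁺; ∈-map⁻; ∈-++⁺ˡ; ∈-++⁺ʳ)
open import Data.List.Relation.Binary.Permutation.Propositional using (_↭_; ↭⇒↭ₛ; ↭-sym; module PermutationReasoning)
open import Data.List.Relation.Binary.Permutation.Propositional.Properties using (shift; ∈-resp-↭; ↭-reverse; ++⁺ˡ; ++⁺ʳ)
import Data.List.Relation.Binary.Permutation.Setoid.Properties as SetoidPermP
open import Data.Nat using (ℕ; zero; suc; _∸_; _^_; _≤_; _<_; z≤n; s≤s; s≤s⁻¹; z<s; s<s; _<ᵇ_; _≡ᵇ_)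
open import Data.Nat.Properties using (_≟_; ≡ᵇ⇒≡; ≡⇒≡ᵇ; ≤-trans; <-trans; <-≤-trans; ≤-<-trans; ≤-refl; n≤1+n; n<1+n; <⇒≤; <⇒≢; ≤∧≢⇒<; m∸n≤m; suc-injective)
open import Data.Product using (Σ; _×_; _,_; proj₁; proj₂)
open import Data.Vec using (_∷_; []; tabulate; lookup)
import Data.Vec as Vec
open import Data.Vec.Properties using (lookup∘tabulate; tabulate∘lookup; tabulate-cong; init-∷ʳ; last-∷ʳ)
open import Function using (_∘_; _↔_; Inverse; mk↔ₛ′; Injection)
open import Function.Properties.Inverse using (↔⇒↣)
open import Relation.Nullary using (yes; no; contradiction)
open import Relation.Binary.PropositionalEquality using (_≡_; _≢_; ≢-sym; refl; sym; trans; cong; cong₂; subst; setoid; module ≡-Reasoning)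

moveOp : ∀ {n} → Subset n → Subset n → Subset n → Subset n
moveOp a b c = a ∪ (b ∩ ∁ c)

lookup-moveOp : ∀ {n} (a b c : Subset n) j →
  lookup (moveOp a b c) j ≡ lookup a j ∨ (lookup b j ∧ not (lookup c j))
lookup-moveOp (x ∷ a) (y ∷ b) (z ∷ c) Fin.zero    = refl
lookup-moveOp (x ∷ a) (y ∷ b) (z ∷ c) (Fin.suc j) = lookup-moveOp a b c j

moveOp-tabulate : ∀ {n} (f g h : Fin n → Bool) →
  moveOp (tabulate f) (tabulate g) (tabulate h) ≡ tabulate (λ j → f j ∨ (g j ∧ not (h j)))
moveOp-tabulate {zero}  f g h = refl
moveOp-tabulate {suc n} f g h = cong ((f Fin.zero ∨ (g Fin.zero ∧ not (h Fin.zero))) ∷_)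
  (moveOp-tabulate (f ∘ Fin.suc) (g ∘ Fin.suc) (h ∘ Fin.suc))

applyMove-hit : ∀ {n} (c : Chain n) i → applyMove c i i ≡ moveSet c i
applyMove-hit c i with i ≡ᵇ i in eq
... | true  = refl
... | false = ⊥-elim (subst T eq (≡⇒≡ᵇ i i refl))

applyMove-miss : ∀ {n} (c : Chain n) {i k} → k ≢ i → applyMove c i k ≡ c k
applyMove-miss c {i} {k} k≢i with k ≡ᵇ i in eq
... | true  = ⊥-elim (k≢i (≡ᵇ⇒≡ k i (subst T (sym eq) tt)))
... | false = refl

run : ∀ {n} → Chain n → List ℕ → Chain n
run c []       = c
run c (i ∷ is) = run (applyMove c i) is

run-++ : ∀ {n} (c : Chain n) xs ys → run c (xs ++ ys) ≡ run (run c xs) ys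
run-++ c []       ys = refl
run-++ c (x ∷ xs) ys = run-++ (applyMove c x) xs ys

produced-++ : ∀ {n} (c : Chain n) xs ys →
  produced c (xs ++ ys) ≡ produced c xs ++ produced (run c xs) ys
produced-++ c []       ys = refl
produced-++ c (x ∷ xs) ys = cong (moveSet c x ∷_) (produced-++ (applyMove c x) xs ys)

produced-++₃ : ∀ {n} (c : Chain n) xs ys zs → produced c (xs ++ ys ++ zs) ≡
  produced c xs ++ produced (run c xs) ys ++ produced (run (run c xs) ys) zs
produced-++₃ c xs ys zs =
  trans (produced-++ c xs (ys ++ zs)) (cong (produced c xs ++_) (produced-++ (run c xs) ys zs))

run-untouched : ∀ {n} (c : Chain n) {k} xs → All (k ≢_) xs → run c xs k ≡ c k
run-untouched c []       []           = refl
run-untouched c (i ∷ xs) (k≢i ∷ k∉xs) =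
  trans (run-untouched (applyMove c i) xs k∉xs) (applyMove-miss c k≢i)

-- c is nested: c j ⊆ c (suc j), stated as c j ∪ (c (suc j) ∖ c j) = c (suc j).
Nested : ∀ {n} → Chain n → Set
Nested c = ∀ j → moveOp (c j) (c (suc j)) (c j) ≡ c (suc j)

MoveHom : ∀ {n n′} → (Subset n → Subset n′) → Set
MoveHom F = ∀ a b c → F (moveOp a b c) ≡ moveOp (F a) (F b) (F c)

moveOp-cong : ∀ {n} {a b c a′ b′ c′ : Subset n} →
  a ≡ a′ → b ≡ b′ → c ≡ c′ → moveOp a b c ≡ moveOp a′ b′ c′
moveOp-cong refl refl refl = refl

moveOp-image : ∀ {n n′} {F : Subset n → Subset n′} → MoveHom F →
  ∀ {a b c} a′ b′ c′ → a ≡ F a′ → b ≡ F b′ → c ≡ F c′ → moveOp a b c ≡ F (moveOp a′ b′ c′)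
moveOp-image hom a′ b′ c′ a≡ b≡ c≡ = trans (moveOp-cong a≡ b≡ c≡) (sym (hom a′ b′ c′))

applyMove-hit₂ : ∀ {n n′} {F : Subset n → Subset n′} (c : Chain n) (d : Chain n′) {i i′} →
  moveSet d i ≡ F (moveSet c i′) → applyMove d i i ≡ F (applyMove c i′ i′)
applyMove-hit₂ {F = F} c d {i} {i′} eq =
  trans (applyMove-hit d i) (trans eq (cong F (sym (applyMove-hit c i′))))

applyMove-miss₂ : ∀ {n n′} {F : Subset n → Subset n′} (c : Chain n) (d : Chain n′) {i i′ k k′} →
  k ≢ i → k′ ≢ i′ → d k ≡ F (c k′) → applyMove d i k ≡ F (applyMove c i′ k′)
applyMove-miss₂ {F = F} c d k≢i k′≢i′ eq =
  trans (applyMove-miss d k≢i) (trans eq (cong F (sym (applyMove-miss c k′≢i′))))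

transport : ∀ {n n′} {F : Subset n → Subset n′} → MoveHom F →
  {c : Chain n} {d : Chain n′} → (∀ k → d k ≡ F (c k)) → ∀ xs →
  produced d xs ≡ map F (produced c xs) × (∀ k → run d xs k ≡ F (run c xs k))
transport hom d≗Fc []       = refl , d≗Fc
transport {F = F} hom {c} {d} d≗Fc (i ∷ xs) =
  cong₂ _∷_ produces (proj₁ rest) , proj₂ rest
  where
  produces : moveSet d i ≡ F (moveSet c i)
  produces = moveOp-image hom _ _ _ (d≗Fc (i ∸ 1)) (d≗Fc (suc i)) (d≗Fc i)

  moved : ∀ k → applyMove d i k ≡ F (applyMove c i k)
  moved k with k ≟ i
  ... | yes refl = applyMove-hit₂ {F = F} c d produces
  ... | no k≢i   = applyMove-miss₂ {F = F} c d k≢i k≢i (d≗Fc k)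

  rest : produced (applyMove d i) xs ≡ map F (produced (applyMove c i) xs)
       × (∀ k → run (applyMove d i) xs k ≡ F (run (applyMove c i) xs k))
  rest = transport hom moved xs

visited : ∀ {n} → Chain n → List ℕ → List (Subset n)
visited {n} c xs = applyUpTo c (suc n) ++ produced c xs

map-visited : ∀ {n n′} (F : Subset n → Subset n′) (c : Chain n) xs →
  map F (visited c xs) ≡ applyUpTo (F ∘ c) (suc n) ++ map F (produced c xs)
map-visited {n} F c xs =
  trans (map-++ F (applyUpTo c (suc n)) (produced c xs)) (cong (_++ map F (produced c xs)) (map-applyUpTo c F (suc n)))

applyUpTo-cong< : ∀ {A : Set} {f g : ℕ → A} r → (∀ k → k < r → f k ≡ g k) →
  applyUpTo f r ≡ applyUpTo g r
applyUpTo-cong< zero    f≗g = refl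
applyUpTo-cong< (suc r) f≗g =
  cong₂ _∷_ (f≗g 0 z<s) (applyUpTo-cong< r (λ k k<r → f≗g (suc k) (s<s k<r)))

Enumerates : {A : Set} → List A → Set
Enumerates xs = Unique xs × (∀ x → x ∈ xs)

enumerates-↭ : {A : Set} {xs ys : List A} → xs ↭ ys → Enumerates xs → Enumerates ys
enumerates-↭ p (unique , complete) =
  SetoidPermP.Unique-resp-↭ (setoid _) (↭⇒↭ₛ p) unique , λ x → ∈-resp-↭ p (complete x)

enumerates-map : {A B : Set} (F : A ↔ B) {xs : List A} →
  Enumerates xs → Enumerates (map (Inverse.to F) xs)
enumerates-map F (unique , complete) =
  UniqueP.map⁺ (Injection.injective (↔⇒↣ F)) unique ,
  λ y → subst (_∈ _) (Inverse.strictlyInverseˡ F y) (∈-map⁺ (Inverse.to F) (complete (Inverse.from F y)))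

enumerates-tagged : {A B : Set} (E : (Bool × A) ↔ B) (b : Bool) {xs ys : List A} →
  Enumerates xs → Enumerates ys →
  Enumerates (map (λ x → Inverse.to E (b , x)) xs ++ map (λ y → Inverse.to E (not b , y)) ys)
enumerates-tagged E b {xs} {ys} (unique , complete) (unique′ , complete′) =
  UniqueP.++⁺ (UniqueP.map⁺ (cong proj₂ ∘ inj) unique) (UniqueP.map⁺ (cong proj₂ ∘ inj) unique′) disjoint ,
  λ z → subst (_∈ _) (Inverse.strictlyInverseˡ E z) (tagged-∈ (proj₁ (Inverse.from E z)) (proj₂ (Inverse.from E z)))
  where
  inj : ∀ {p q} → Inverse.to E p ≡ Inverse.to E q → p ≡ q
  inj = Injection.injective (↔⇒↣ E)

  disjoint : ∀ {z} → z ∈ map (λ x → Inverse.to E (b , x)) xs × z ∈ map (λ y → Inverse.to E (not b , y)) ys → ⊥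
  disjoint (z∈xs , z∈ys) with ∈-map⁻ _ z∈xs | ∈-map⁻ _ z∈ys
  ... | _ , _ , refl | _ , _ , eq = not-¬ refl (cong proj₁ (inj eq))

  tagged-∈ : ∀ b′ x → Inverse.to E (b′ , x) ∈ map (λ x → Inverse.to E (b , x)) xs ++ map (λ y → Inverse.to E (not b , y)) ys
  tagged-∈ b′ x with b′ Bool.≟ b
  ... | yes refl = ∈-++⁺ˡ (∈-map⁺ _ (complete x))
  ... | no b′≢b  = subst (λ b″ → Inverse.to E (b″ , x) ∈ _) (sym (¬-not b′≢b)) (∈-++⁺ʳ _ (∈-map⁺ _ (complete′ x)))

relabel : ∀ {n} → Permutation′ n → Subset n → Subset n
relabel π s = tabulate (λ j → lookup s (π ⟨$⟩ʳ j))

relabel-hom : ∀ {n} (π : Permutation′ n) → MoveHom (relabel π)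
relabel-hom π a b c = trans
  (tabulate-cong (λ j → lookup-moveOp a b c (π ⟨$⟩ʳ j)))
  (sym (moveOp-tabulate _ _ _))

relabel-∘ : ∀ {n} (π σ : Permutation′ n) s → relabel π (relabel σ s) ≡ relabel (π ∘ₚ σ) s
relabel-∘ π σ s = tabulate-cong (λ j → lookup∘tabulate _ (π ⟨$⟩ʳ j))

relabel-cancel : ∀ {n} (π σ : Permutation′ n) → (∀ j → π ⟨$⟩ʳ (σ ⟨$⟩ʳ j) ≡ j) →
  ∀ s → relabel σ (relabel π s) ≡ s
relabel-cancel π σ πσ≗id s = trans (relabel-∘ σ π s)
  (trans (tabulate-cong (λ j → cong (lookup s) (πσ≗id j))) (tabulate∘lookup s))

relabel↔ : ∀ {n} → Permutation′ n → Subset n ↔ Subset n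
relabel↔ π = mk↔ₛ′ (relabel π) (relabel (flip π))
  (relabel-cancel (flip π) π (λ _ → inverseˡ π))
  (relabel-cancel π (flip π) (λ _ → inverseʳ π))

IsFlag : ∀ {n} → Chain n → Set
IsFlag {n} c = Σ (Permutation′ n) λ π → ∀ k → c k ≡ relabel π (initChain n k)

initChain-flag : ∀ n → IsFlag (initChain n)
initChain-flag n = id , λ k → sym (tabulate∘lookup (initChain n k))

swapNext : ℕ → ℕ → ℕ
swapNext zero    zero          = 1
swapNext zero    (suc zero)    = 0
swapNext zero    (suc (suc t)) = suc (suc t)
swapNext (suc i) zero          = 0
swapNext (suc i) (suc t)       = suc (swapNext i t)

swapNext-involutive : ∀ i t → swapNext i (swapNext i t) ≡ t
swapNext-involutive zero    zero          = refl
swapNext-involutive zero    (suc zero)    = refl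
swapNext-involutive zero    (suc (suc t)) = refl
swapNext-involutive (suc i) zero          = refl
swapNext-involutive (suc i) (suc t)       = cong suc (swapNext-involutive i t)

swapNext-< : ∀ {n} i t → t < n → suc i < n → swapNext i t < n
swapNext-< zero    zero          t<n i<n = i<n
swapNext-< zero    (suc zero)    t<n i<n = <-≤-trans z<s t<n
swapNext-< zero    (suc (suc t)) t<n i<n = t<n
swapNext-< (suc i) zero          t<n i<n = t<n
swapNext-< (suc i) (suc t) (s≤s t<n) (s≤s i<n) = s≤s (swapNext-< i t t<n i<n)

-- Bitwise: the move at suc i turns the initial chain's membership test
-- "t < suc i" into "swapNext i t < suc i", and leaves the other tests alone.
swapNext-move : ∀ i t →
  (t <ᵇ i) ∨ ((t <ᵇ suc (suc i)) ∧ not (t <ᵇ suc i)) ≡ (swapNext i t <ᵇ suc i)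
swapNext-move zero    zero          = refl
swapNext-move zero    (suc zero)    = refl
swapNext-move zero    (suc (suc t)) = refl
swapNext-move (suc i) zero          = refl
swapNext-move (suc i) (suc t)       = swapNext-move i t

swapNext-other : ∀ i t k → k ≢ suc i → (t <ᵇ k) ≡ (swapNext i t <ᵇ k)
swapNext-other zero    zero          zero          k≢ = refl
swapNext-other zero    zero          (suc zero)    k≢ = contradiction refl k≢
swapNext-other zero    zero          (suc (suc k)) k≢ = refl
swapNext-other zero    (suc zero)    zero          k≢ = refl
swapNext-other zero    (suc zero)    (suc zero)    k≢ = contradiction refl k≢
swapNext-other zero    (suc zero)    (suc (suc k)) k≢ = refl
swapNext-other zero    (suc (suc t)) k             k≢ = refl
swapNext-other (suc i) zero          k             k≢ = refl
swapNext-other (suc i) (suc t)       zero          k≢ = refl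
swapNext-other (suc i) (suc t)       (suc k)       k≢ = swapNext-other i t k (k≢ ∘ cong suc)

transposeNext : ∀ {n} i → suc i < n → Permutation′ n
transposeNext i i+1<n = permutation swap swap involutive involutive
  where
  swap : Fin _ → Fin _
  swap t = fromℕ< (swapNext-< i (toℕ t) (toℕ<n t) i+1<n)
  involutive : ∀ t → swap (swap t) ≡ t
  involutive t = toℕ-injective (trans (toℕ-fromℕ< _)
    (trans (cong (swapNext i) (toℕ-fromℕ< _)) (swapNext-involutive i (toℕ t))))

toℕ-transposeNext : ∀ {n} i (i+1<n : suc i < n) t →
  toℕ (transposeNext i i+1<n ⟨$⟩ʳ t) ≡ swapNext i (toℕ t)
toℕ-transposeNext i i+1<n t = toℕ-fromℕ< _

initChain-move : ∀ n i (i+1<n : suc i < n) k →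
  applyMove (initChain n) (suc i) k ≡ relabel (transposeNext i i+1<n) (initChain n k)
initChain-move n i i+1<n k with k ≟ suc i
... | yes refl = begin
  applyMove (initChain n) k k  ≡⟨ applyMove-hit (initChain n) k ⟩
  moveSet (initChain n) (suc i) ≡⟨ moveOp-tabulate _ _ _ ⟩
  tabulate (λ j → (toℕ j <ᵇ i) ∨ ((toℕ j <ᵇ suc (suc i)) ∧ not (toℕ j <ᵇ suc i)))
    ≡⟨ tabulate-cong (λ j → swapNext-move i (toℕ j)) ⟩
  tabulate (λ j → swapNext i (toℕ j) <ᵇ suc i)
    ≡⟨ tabulate-cong (λ j → cong (_<ᵇ suc i) (toℕ-transposeNext i i+1<n j)) ⟨
  tabulate (λ j → toℕ (τ ⟨$⟩ʳ j) <ᵇ suc i)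
    ≡⟨ tabulate-cong (λ j → lookup∘tabulate _ (τ ⟨$⟩ʳ j)) ⟨
  relabel τ (initChain n (suc i)) ∎
  where
  open ≡-Reasoning
  τ = transposeNext i i+1<n
... | no k≢ = trans (applyMove-miss (initChain n) k≢)
  (tabulate-cong (λ j → trans (swapNext-other i (toℕ j) k k≢)
    (trans (cong (_<ᵇ k) (sym (toℕ-transposeNext i i+1<n j)))
      (sym (lookup∘tabulate _ (transposeNext i i+1<n ⟨$⟩ʳ j))))))

-- Bitwise: S_j ⊆ S_{j+1} for the initial chain.
lt-step : ∀ t j → (t <ᵇ j) ∨ ((t <ᵇ suc j) ∧ not (t <ᵇ j)) ≡ (t <ᵇ suc j)
lt-step zero    zero    = refl
lt-step zero    (suc j) = refl
lt-step (suc t) zero    = refl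
lt-step (suc t) (suc j) = lt-step t j

initChain-nested : ∀ n → Nested (initChain n)
initChain-nested n j = trans (moveOp-tabulate _ _ _) (tabulate-cong (λ x → lt-step (toℕ x) j))

ValidMove : ℕ → ℕ → Set
ValidMove n i = 1 ≤ i × i ≤ n ∸ 1

valid⇒< : ∀ {n i} → ValidMove n i → i < n
valid⇒< {zero}  (1≤i , i≤0) = contradiction (≤-trans 1≤i i≤0) λ ()
valid⇒< {suc n} (_ , i≤n)   = s≤s i≤n

valid-suc : ∀ {n i} → ValidMove n i → ValidMove (suc n) (suc i)
valid-suc v = s≤s z≤n , valid⇒< v

valid-weaken : ∀ {n i} → ValidMove n i → ValidMove (suc n) i
valid-weaken v = proj₁ v , <⇒≤ (valid⇒< v)

-- Valid moves keep a chain a flag; the relabelling picks up the adjacent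
-- transposition of the move.
flag-step : ∀ {n} {c : Chain n} → IsFlag c → ∀ i → suc i < n → IsFlag (applyMove c (suc i))
flag-step {n} {c} (π , c≗) i i+1<n = π ∘ₚ τ , λ k → begin
  applyMove c (suc i) k                         ≡⟨ proj₂ (transport (relabel-hom π) c≗ [ suc i ]) k ⟩
  relabel π (applyMove (initChain n) (suc i) k) ≡⟨ cong (relabel π) (initChain-move n i i+1<n k) ⟩
  relabel π (relabel τ (initChain n k))         ≡⟨ relabel-∘ π τ (initChain n k) ⟩
  relabel (π ∘ₚ τ) (initChain n k)              ∎
  where
  open ≡-Reasoning
  τ = transposeNext i i+1<n

flag-run : ∀ {n} {c : Chain n} → IsFlag c → ∀ xs → All (ValidMove n) xs → IsFlag (run c xs)
flag-run flag []             []       = flag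
flag-run flag (zero ∷ xs)    ((() , _) ∷ _)
flag-run flag (suc i ∷ xs)   (v ∷ vs) = flag-run (flag-step flag i (valid⇒< v)) xs vs

flag-nested : ∀ {n} {c : Chain n} → IsFlag c → Nested c
flag-nested {n} {c} (π , c≗) j = begin
  moveOp (c j) (c (suc j)) (c j)
    ≡⟨ moveOp-image (relabel-hom π) (initChain n j) (initChain n (suc j)) (initChain n j) (c≗ j) (c≗ (suc j)) (c≗ j) ⟩
  relabel π (moveOp (initChain n j) (initChain n (suc j)) (initChain n j))
    ≡⟨ cong (relabel π) (initChain-nested n j) ⟩
  relabel π (initChain n (suc j))
    ≡⟨ c≗ (suc j) ⟨
  c (suc j) ∎
  where open ≡-Reasoning

-- A sequence visits from a flag the relabelled sets it visits from the
-- initial chain; so a stepping sequence enumerates all subsets from any flag.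
flag-enumerates : ∀ {n} {c : Chain n} → IsFlag c → ∀ xs →
  Enumerates (allSets n xs) → Enumerates (visited c xs)
flag-enumerates {n} {c} (π , c≗) xs enum = subst Enumerates (sym visited-eq) (enumerates-map (relabel↔ π) enum)
  where
  open ≡-Reasoning
  visited-eq : visited c xs ≡ map (relabel π) (allSets n xs)
  visited-eq = begin
    applyUpTo c (suc n) ++ produced c xs
      ≡⟨ cong₂ _++_ (applyUpTo-cong< (suc n) (λ k _ → c≗ k)) (proj₁ (transport (relabel-hom π) c≗ xs)) ⟩
    applyUpTo (relabel π ∘ initChain n) (suc n) ++ map (relabel π) (produced (initChain n) xs)
      ≡⟨ cong (_++ map (relabel π) (produced (initChain n) xs)) (map-applyUpTo (initChain n) (relabel π) (suc n)) ⟨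
    map (relabel π) (initialSets n) ++ map (relabel π) (produced (initChain n) xs)
      ≡⟨ map-++ (relabel π) (initialSets n) _ ⟨
    map (relabel π) (allSets n xs) ∎

moveOp-absorb : ∀ {n} (a b : Subset n) → moveOp a b b ≡ a
moveOp-absorb a b = trans (cong (a ∪_) (∩-inverseʳ b)) (∪-identityʳ a)

-- A bijection (membership of the new element, rest) ↔ subsets of the larger
-- ground set, under which the move operation acts bitwise on the new element.
record Extension (n : ℕ) : Set where
  field
    tagging : (Bool × Subset n) ↔ Subset (suc n)

  tag : Bool → Subset n → Subset (suc n)
  tag b s = Inverse.to tagging (b , s)

  field
    tag-moveOp : ∀ p q r a b c →
      moveOp (tag p a) (tag q b) (tag r c) ≡ tag (p ∨ (q ∧ not r)) (moveOp a b c)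

  -- Fixing the new bit gives a move homomorphism, since b ∨ (b ∧ not b) = b.
  tag-hom : ∀ b → MoveHom (tag b)
  tag-hom b s t u = sym (trans (tag-moveOp b b b s t u)
    (cong (λ x → tag x (moveOp s t u)) (trans (cong (b ∨_) (∧-inverseʳ b)) (∨-identityʳ b))))

-- The new element is the first one: prepend a bit.
prefixExtension : ∀ n → Extension n
prefixExtension n = record
  { tagging    = mk↔ₛ′ (λ (b , s) → b ∷ s) (λ { (b ∷ s) → b , s }) (λ { (b ∷ s) → refl }) (λ (b , s) → refl)
  ; tag-moveOp = λ _ _ _ _ _ _ → refl
  }

∷ʳ-moveOp : ∀ {n} (a b c : Subset n) p q r →
  moveOp (a Vec.∷ʳ p) (b Vec.∷ʳ q) (c Vec.∷ʳ r) ≡ moveOp a b c Vec.∷ʳ (p ∨ (q ∧ not r))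
∷ʳ-moveOp []      []      []      p q r = refl
∷ʳ-moveOp (x ∷ a) (y ∷ b) (z ∷ c) p q r = cong ((x ∨ (y ∧ not z)) ∷_) (∷ʳ-moveOp a b c p q r)

-- The new element is the last one: append a bit.
suffixExtension : ∀ n → Extension n
suffixExtension n = record
  { tagging    = mk↔ₛ′ (λ (b , s) → s Vec.∷ʳ b) (λ s → Vec.last s , Vec.init s)
                   (λ s → sym (proj₂ (proj₂ (Vec.initLast s))))
                   (λ (b , s) → cong₂ _,_ (last-∷ʳ b s) (init-∷ʳ b s))
  ; tag-moveOp = λ p q r a b c → ∷ʳ-moveOp a b c p q r
  }

module Split {n} (E : Extension n) where
  open Extension E

  SplitAt : Chain n → ℕ → Chain (suc n) → Set
  SplitAt c j d = (∀ k → k ≤ j → d k ≡ tag false (c k))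
                × (∀ k → j < k → d k ≡ tag true (c (k ∸ 1)))

  lower-step : ∀ {c j d i} → SplitAt c j d → i < j →
    moveSet d i ≡ tag false (moveSet c i) × SplitAt (applyMove c i) j (applyMove d i)
  lower-step {c} {j} {d} {i} (below , above) i<j = produces , below′ , above′
    where
    produces : moveSet d i ≡ tag false (moveSet c i)
    produces = moveOp-image (tag-hom false) _ _ _
      (below (i ∸ 1) (≤-trans (m∸n≤m i 1) (<⇒≤ i<j))) (below (suc i) i<j) (below i (<⇒≤ i<j))

    below′ : ∀ k → k ≤ j → applyMove d i k ≡ tag false (applyMove c i k)
    below′ k k≤j with k ≟ i
    ... | yes refl = applyMove-hit₂ {F = tag false} c d produces
    ... | no k≢i   = applyMove-miss₂ {F = tag false} c d k≢i k≢i (below k k≤j)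

    above′ : ∀ k → j < k → applyMove d i k ≡ tag true (applyMove c i (k ∸ 1))
    above′ (suc k) j<1+k = applyMove-miss₂ {F = tag true} c d (≢-sym (<⇒≢ (≤-trans i<k (n≤1+n k)))) (≢-sym (<⇒≢ i<k))
      (above (suc k) j<1+k)
      where
      i<k : i < k
      i<k = <-≤-trans i<j (s≤s⁻¹ j<1+k)

  upper-step : ∀ {c j d i} → SplitAt c j d → j < i →
    moveSet d (suc i) ≡ tag true (moveSet c i) × SplitAt (applyMove c i) j (applyMove d (suc i))
  upper-step {c} {j} {d} {i} (below , above) j<i = produces , below′ , above′
    where
    produces : moveSet d (suc i) ≡ tag true (moveSet c i)
    produces = moveOp-image (tag-hom true) _ _ _
      (above i j<i) (above (suc (suc i)) (<-trans j<i (<-trans (n<1+n i) (n<1+n (suc i)))))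
      (above (suc i) (<-trans j<i (n<1+n i)))

    below′ : ∀ k → k ≤ j → applyMove d (suc i) k ≡ tag false (applyMove c i k)
    below′ k k≤j = applyMove-miss₂ {F = tag false} c d (<⇒≢ (<-trans k<i (n<1+n i))) (<⇒≢ k<i) (below k k≤j)
      where
      k<i : k < i
      k<i = ≤-<-trans k≤j j<i

    above′ : ∀ k → j < k → applyMove d (suc i) k ≡ tag true (applyMove c i (k ∸ 1))
    above′ (suc k) j<1+k with k ≟ i
    ... | yes refl = applyMove-hit₂ {F = tag true} c d produces
    ... | no k≢i   = applyMove-miss₂ {F = tag true} c d (k≢i ∘ suc-injective) k≢i (above (suc k) j<1+k)

  up-step : ∀ {c j d} → moveOp (c j) (c (suc j)) (c j) ≡ c (suc j) → SplitAt c j d →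
    moveSet d (suc j) ≡ tag false (c (suc j)) × SplitAt c (suc j) (applyMove d (suc j))
  up-step {c} {j} {d} nested (below , above) = produces , below′ , above′
    where
    produces : moveSet d (suc j) ≡ tag false (c (suc j))
    produces = begin
      moveOp (d j) (d (suc (suc j))) (d (suc j))
        ≡⟨ moveOp-cong (below j ≤-refl) (above (suc (suc j)) (<-trans (n<1+n j) (n<1+n (suc j)))) (above (suc j) (n<1+n j)) ⟩
      moveOp (tag false (c j)) (tag true (c (suc j))) (tag true (c j))
        ≡⟨ tag-moveOp false true true _ _ _ ⟩
      tag false (moveOp (c j) (c (suc j)) (c j))
        ≡⟨ cong (tag false) nested ⟩
      tag false (c (suc j)) ∎
      where open ≡-Reasoning

    below′ : ∀ k → k ≤ suc j → applyMove d (suc j) k ≡ tag false (c k)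
    below′ k k≤1+j with k ≟ suc j
    ... | yes refl = trans (applyMove-hit d k) produces
    ... | no k≢    = trans (applyMove-miss d k≢) (below k (s≤s⁻¹ (≤∧≢⇒< k≤1+j k≢)))

    above′ : ∀ k → suc j < k → applyMove d (suc j) k ≡ tag true (c (k ∸ 1))
    above′ k 1+j<k = trans (applyMove-miss d (≢-sym (<⇒≢ 1+j<k))) (above k (<-trans (n<1+n j) 1+j<k))

  down-step : ∀ {c j d} → SplitAt c (suc j) d →
    moveSet d (suc j) ≡ tag true (c j) × SplitAt c j (applyMove d (suc j))
  down-step {c} {j} {d} (below , above) = produces , below′ , above′
    where
    produces : moveSet d (suc j) ≡ tag true (c j)
    produces = begin
      moveOp (d j) (d (suc (suc j))) (d (suc j))
        ≡⟨ moveOp-cong (below j (n≤1+n j)) (above (suc (suc j)) (n<1+n (suc j))) (below (suc j) ≤-refl) ⟩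
      moveOp (tag false (c j)) (tag true (c (suc j))) (tag false (c (suc j)))
        ≡⟨ tag-moveOp false true false _ _ _ ⟩
      tag true (moveOp (c j) (c (suc j)) (c (suc j)))
        ≡⟨ cong (tag true) (moveOp-absorb (c j) (c (suc j))) ⟩
      tag true (c j) ∎
      where open ≡-Reasoning

    below′ : ∀ k → k ≤ j → applyMove d (suc j) k ≡ tag false (c k)
    below′ k k≤j = trans (applyMove-miss d (<⇒≢ (s≤s k≤j))) (below k (≤-trans k≤j (n≤1+n j)))

    above′ : ∀ k → j < k → applyMove d (suc j) k ≡ tag true (c (k ∸ 1))
    above′ k j<k with k ≟ suc j
    ... | yes refl = trans (applyMove-hit d k) produces
    ... | no k≢    = trans (applyMove-miss d k≢) (above k (≤∧≢⇒< j<k (≢-sym k≢)))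

  lower-run : ∀ {c j d} → SplitAt c j d → ∀ xs → All (_< j) xs →
    produced d xs ≡ map (tag false) (produced c xs) × SplitAt (run c xs) j (run d xs)
  lower-run split []       []          = refl , split
  lower-run split (i ∷ xs) (i<j ∷ xs<j) =
    let (produces , split′) = lower-step split i<j
        (rest , split″)     = lower-run split′ xs xs<j
    in cong₂ _∷_ produces rest , split″

  upper-run : ∀ {c j d} → SplitAt c j d → ∀ xs → All (j <_) xs →
    produced d (map suc xs) ≡ map (tag true) (produced c xs) × SplitAt (run c xs) j (run d (map suc xs))
  upper-run split []       []          = refl , split
  upper-run split (i ∷ xs) (j<i ∷ j<xs) =
    let (produces , split′) = upper-step split j<i
        (rest , split″)     = upper-run split′ xs j<xs
    in cong₂ _∷_ produces rest , split″

  sweep-up : ∀ {c d} → Nested c → SplitAt c 0 d → ∀ r →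
    produced d (applyUpTo suc r) ≡ applyUpTo (tag false ∘ c ∘ suc) r × SplitAt c r (run d (applyUpTo suc r))
  sweep-up nested split zero    = refl , split
  sweep-up {c} {d} nested split (suc r) = produces , subst (SplitAt c (suc r)) (sym run-eq) (proj₂ step)
    where
    open ≡-Reasoning
    moves : List ℕ
    moves = applyUpTo suc r
    previous : produced d moves ≡ applyUpTo (tag false ∘ c ∘ suc) r × SplitAt c r (run d moves)
    previous = sweep-up nested split r
    step : moveSet (run d moves) (suc r) ≡ tag false (c (suc r))
         × SplitAt c (suc r) (applyMove (run d moves) (suc r))
    step = up-step (nested r) (proj₂ previous)

    run-eq : run d (applyUpTo suc (suc r)) ≡ applyMove (run d moves) (suc r)
    run-eq = trans (cong (run d) (sym (applyUpTo-∷ʳ suc r))) (run-++ d moves [ suc r ])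

    produces : produced d (applyUpTo suc (suc r)) ≡ applyUpTo (tag false ∘ c ∘ suc) (suc r)
    produces = begin
      produced d (applyUpTo suc (suc r))                  ≡⟨ cong (produced d) (applyUpTo-∷ʳ suc r) ⟨
      produced d (moves ++ [ suc r ])                     ≡⟨ produced-++ d moves [ suc r ] ⟩
      produced d moves ++ [ moveSet (run d moves) (suc r) ] ≡⟨ cong₂ (λ xs x → xs ++ [ x ]) (proj₁ previous) (proj₁ step) ⟩
      applyUpTo (tag false ∘ c ∘ suc) r ++ [ tag false (c (suc r)) ] ≡⟨ applyUpTo-∷ʳ (tag false ∘ c ∘ suc) r ⟩
      applyUpTo (tag false ∘ c ∘ suc) (suc r) ∎

  sweep-down : ∀ {c d} j → SplitAt c j d →
    produced d (applyDownFrom suc j) ≡ applyDownFrom (tag true ∘ c) j × SplitAt c 0 (run d (applyDownFrom suc j))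
  sweep-down zero    split = refl , split
  sweep-down (suc j) split =
    let (produces , split′) = down-step split
        (rest , split″)     = sweep-down j split′
    in cong₂ _∷_ produces rest , split″

<ᵇ-true : ∀ {m n} → m < n → (m <ᵇ n) ≡ true
<ᵇ-true {zero}  {suc n} _         = refl
<ᵇ-true {suc m} {suc n} (s≤s m<n) = <ᵇ-true m<n

<ᵇ-false : ∀ {m n} → n ≤ m → (m <ᵇ n) ≡ false
<ᵇ-false {m}     {zero}  _         = refl
<ᵇ-false {suc m} {suc n} (s≤s n≤m) = <ᵇ-false n≤m

tabulate-∷ʳ : ∀ n (g : ℕ → Bool) →
  tabulate {n = suc n} (g ∘ toℕ) ≡ tabulate {n = n} (g ∘ toℕ) Vec.∷ʳ g n
tabulate-∷ʳ zero    g = refl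
tabulate-∷ʳ (suc n) g = cong (g 0 ∷_) (tabulate-∷ʳ n (g ∘ suc))

-- Along the first element, S_0 = ∅ avoids it and S_{k+1} = {1} ∪ (S_k shifted):
-- the initial chain of length n+1 is the initial chain of length n split at 0.
initChain-split-prefix : ∀ n → Split.SplitAt (prefixExtension n) (initChain n) 0 (initChain (suc n))
initChain-split-prefix n = (λ { zero _ → refl }) , (λ { (suc k) _ → refl })

initialSets-prefix : ∀ n → initialSets (suc n) ≡ (false ∷ initChain n 0) ∷ map (true ∷_) (initialSets n)
initialSets-prefix n = cong ((false ∷ initChain n 0) ∷_) (sym (map-applyUpTo (initChain n) (true ∷_) (suc n)))

-- Along the last element, S_0, …, S_n avoid it and S_{n+1} = S_n ∪ {n+1}:
-- the initial chain of length n+1 is the initial chain of length n split at n.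
initChain-split-suffix : ∀ n → Split.SplitAt (suffixExtension n) (initChain n) n (initChain (suc n))
initChain-split-suffix n = below , above
  where
  below : ∀ k → k ≤ n → initChain (suc n) k ≡ initChain n k Vec.∷ʳ false
  below k k≤n = trans (tabulate-∷ʳ n (_<ᵇ k)) (cong (initChain n k Vec.∷ʳ_) (<ᵇ-false k≤n))

  above : ∀ k → n < k → initChain (suc n) k ≡ initChain n (k ∸ 1) Vec.∷ʳ true
  above (suc k) (s≤s n≤k) = trans (tabulate-∷ʳ n (_<ᵇ suc k)) (cong₂ Vec._∷ʳ_ full (<ᵇ-true (s≤s n≤k)))
    where
    full : initChain n (suc k) ≡ initChain n k
    full = tabulate-cong λ j →
      trans (<ᵇ-true (<-≤-trans (toℕ<n j) (≤-trans n≤k (n≤1+n k)))) (sym (<ᵇ-true (<-≤-trans (toℕ<n j) n≤k)))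

initialSets-suffix : ∀ n →
  initialSets (suc n) ≡ map (Vec._∷ʳ false) (initialSets n) ++ [ initChain n n Vec.∷ʳ true ]
initialSets-suffix n = trans (sym (applyUpTo-∷ʳ (initChain (suc n)) (suc n))) (cong₂ (λ xs x → xs ++ [ x ]) lower top)
  where
  lower : applyUpTo (initChain (suc n)) (suc n) ≡ map (Vec._∷ʳ false) (initialSets n)
  lower = trans (applyUpTo-cong< (suc n) (λ k k<1+n → proj₁ (initChain-split-suffix n) k (s≤s⁻¹ k<1+n)))
    (sym (map-applyUpTo (initChain n) (Vec._∷ʳ false) (suc n)))
  top : initChain (suc n) (suc n) ≡ initChain n n Vec.∷ʳ true
  top = proj₂ (initChain-split-suffix n) (suc n) ≤-refl

produced-up : ∀ n is is′ → All (ValidMove n) is → All (ValidMove n) is′ →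
  let c = run (initChain n) is in
  produced (initChain (suc n)) (map suc is ++ applyUpTo suc n ++ is′)
  ≡ map (true ∷_) (produced (initChain n) is) ++ applyUpTo ((false ∷_) ∘ c ∘ suc) n ++ map (false ∷_) (produced c is′)
produced-up n is is′ valid valid′ =
  trans (produced-++₃ (initChain (suc n)) (map suc is) (applyUpTo suc n) is′)
    (cong₂ _++_ (proj₁ phase₁) (cong₂ _++_ (proj₁ phase₂) (proj₁ phase₃)))
  where
  open Extension (prefixExtension n)
  open Split (prefixExtension n)

  c : Chain n
  c = run (initChain n) is
  d₁ d₂ : Chain (suc n)
  d₁ = run (initChain (suc n)) (map suc is)
  d₂ = run d₁ (applyUpTo suc n)

  phase₁ : produced (initChain (suc n)) (map suc is) ≡ map (tag true) (produced (initChain n) is) × SplitAt c 0 d₁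
  phase₁ = upper-run (initChain-split-prefix n) is (mapAll proj₁ valid)
  phase₂ : produced d₁ (applyUpTo suc n) ≡ applyUpTo (tag false ∘ c ∘ suc) n × SplitAt c n d₂
  phase₂ = sweep-up (flag-nested (flag-run (initChain-flag n) is valid)) (proj₂ phase₁) n
  phase₃ : produced d₂ is′ ≡ map (tag false) (produced c is′) × SplitAt (run c is′) n (run d₂ is′)
  phase₃ = lower-run (proj₂ phase₂) is′ (mapAll valid⇒< valid′)

allSets-up : ∀ n is is′ → All (ValidMove n) is → All (ValidMove n) is′ →
  let c = run (initChain n) is in
  allSets (suc n) (map suc is ++ applyUpTo suc n ++ is′)
  ≡ (false ∷ c 0) ∷ map (true ∷_) (allSets n is)
    ++ applyUpTo ((false ∷_) ∘ c ∘ suc) n ++ map (false ∷_) (produced c is′)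
allSets-up n is is′ valid valid′ = begin
  initialSets (suc n) ++ produced (initChain (suc n)) (map suc is ++ applyUpTo suc n ++ is′)
    ≡⟨ cong₂ _++_ (initialSets-prefix n) (produced-up n is is′ valid valid′) ⟩
  (false ∷ initChain n 0) ∷ initial ++ (first ++ rest)
    ≡⟨ cong₂ _∷_ (cong (false ∷_) c₀) (++-assoc initial first rest) ⟨
  (false ∷ c 0) ∷ (initial ++ first) ++ rest
    ≡⟨ cong (λ xs → (false ∷ c 0) ∷ xs ++ rest) (map-++ (true ∷_) (initialSets n) _) ⟨
  (false ∷ c 0) ∷ map (true ∷_) (allSets n is) ++ rest ∎
  where
  open ≡-Reasoning
  c : Chain n
  c = run (initChain n) is
  c₀ : c 0 ≡ initChain n 0
  c₀ = run-untouched (initChain n) is (mapAll (λ v → <⇒≢ (proj₁ v)) valid)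

  initial first rest : List (Subset (suc n))
  initial = map (true ∷_) (initialSets n)
  first   = map (true ∷_) (produced (initChain n) is)
  rest    = applyUpTo ((false ∷_) ∘ c ∘ suc) n ++ map (false ∷_) (produced c is′)

-- The first construction is a stepping sequence: its sets are, up to order,
-- the sets visited by is with 1 added and those visited by is′ from the flag
-- c without 1.
stepping-up : ∀ n is is′ → IsStepping n is → IsStepping n is′ →
  IsStepping (suc n) (map suc is ++ applyUpTo suc n ++ is′)
stepping-up n is is′ (valid , enum) (valid′ , enum′) =
  valid-seq ,
  enumerates-↭ (↭-sym bag) (enumerates-tagged tagging true enum (flag-enumerates flag is′ enum′))
  where
  open Extension (prefixExtension n)

  c : Chain n
  c = run (initChain n) is
  flag : IsFlag c
  flag = flag-run (initChain-flag n) is valid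

  valid-seq : All (ValidMove (suc n)) (map suc is ++ applyUpTo suc n ++ is′)
  valid-seq = AllP.++⁺ (AllP.map⁺ (mapAll valid-suc valid))
    (AllP.++⁺ (AllP.applyUpTo⁺₁ suc n (λ i<n → s≤s z≤n , i<n)) (mapAll valid-weaken valid′))

  rest : List (Subset (suc n))
  rest = applyUpTo (tag false ∘ c ∘ suc) n ++ map (tag false) (produced c is′)

  bag : allSets (suc n) (map suc is ++ applyUpTo suc n ++ is′)
        ↭ map (tag true) (allSets n is) ++ map (tag false) (visited c is′)
  bag = begin
    allSets (suc n) (map suc is ++ applyUpTo suc n ++ is′)
      ≡⟨ allSets-up n is is′ valid valid′ ⟩
    tag false (c 0) ∷ map (tag true) (allSets n is) ++ rest
      ↭⟨ shift (tag false (c 0)) (map (tag true) (allSets n is)) rest ⟨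
    map (tag true) (allSets n is) ++ (tag false (c 0) ∷ rest)
      ≡⟨ cong (map (tag true) (allSets n is) ++_) (map-visited (tag false) c is′) ⟨
    map (tag true) (allSets n is) ++ map (tag false) (visited c is′) ∎
    where open PermutationReasoning

produced-down : ∀ n is is′ → All (ValidMove n) is → All (ValidMove n) is′ →
  let c = run (initChain n) is in
  produced (initChain (suc n)) (is ++ applyDownFrom suc n ++ map suc is′)
  ≡ map (Vec._∷ʳ false) (produced (initChain n) is) ++ applyDownFrom ((Vec._∷ʳ true) ∘ c) n
    ++ map (Vec._∷ʳ true) (produced c is′)
produced-down n is is′ valid valid′ =
  trans (produced-++₃ (initChain (suc n)) is (applyDownFrom suc n) (map suc is′))
    (cong₂ _++_ (proj₁ phase₁) (cong₂ _++_ (proj₁ phase₂) (proj₁ phase₃)))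
  where
  open Extension (suffixExtension n)
  open Split (suffixExtension n)

  c : Chain n
  c = run (initChain n) is
  d₁ d₂ : Chain (suc n)
  d₁ = run (initChain (suc n)) is
  d₂ = run d₁ (applyDownFrom suc n)

  phase₁ : produced (initChain (suc n)) is ≡ map (tag false) (produced (initChain n) is) × SplitAt c n d₁
  phase₁ = lower-run (initChain-split-suffix n) is (mapAll valid⇒< valid)
  phase₂ : produced d₁ (applyDownFrom suc n) ≡ applyDownFrom (tag true ∘ c) n × SplitAt c 0 d₂
  phase₂ = sweep-down n (proj₂ phase₁)
  phase₃ : produced d₂ (map suc is′) ≡ map (tag true) (produced c is′) × SplitAt (run c is′) 0 (run d₂ (map suc is′))
  phase₃ = upper-run (proj₂ phase₂) is′ (mapAll proj₁ valid′)

applyDownFrom↭applyUpTo : ∀ {A : Set} (f : ℕ → A) r → applyDownFrom f r ↭ applyUpTo f r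
applyDownFrom↭applyUpTo f r = subst (_↭ applyUpTo f r) (reverse-applyUpTo f r) (↭-reverse (applyUpTo f r))

allSets-down : ∀ n is is′ → All (ValidMove n) is → All (ValidMove n) is′ →
  let c = run (initChain n) is in
  allSets (suc n) (is ++ applyDownFrom suc n ++ map suc is′)
  ≡ map (Vec._∷ʳ false) (initialSets n) ++ (c n Vec.∷ʳ true) ∷ map (Vec._∷ʳ false) (produced (initChain n) is)
    ++ applyDownFrom ((Vec._∷ʳ true) ∘ c) n ++ map (Vec._∷ʳ true) (produced c is′)
allSets-down n is is′ valid valid′ = begin
  initialSets (suc n) ++ produced (initChain (suc n)) (is ++ applyDownFrom suc n ++ map suc is′)
    ≡⟨ cong₂ _++_ (initialSets-suffix n) (produced-down n is is′ valid valid′) ⟩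
  (initial ++ [ initChain n n Vec.∷ʳ true ]) ++ rest
    ≡⟨ ++-assoc initial [ initChain n n Vec.∷ʳ true ] rest ⟩
  initial ++ (initChain n n Vec.∷ʳ true) ∷ rest
    ≡⟨ cong (λ s → initial ++ (s Vec.∷ʳ true) ∷ rest) cₙ ⟨
  initial ++ (c n Vec.∷ʳ true) ∷ rest ∎
  where
  open ≡-Reasoning
  c : Chain n
  c = run (initChain n) is
  cₙ : c n ≡ initChain n n
  cₙ = run-untouched (initChain n) is (mapAll (λ v → ≢-sym (<⇒≢ (valid⇒< v))) valid)

  initial rest : List (Subset (suc n))
  initial = map (Vec._∷ʳ false) (initialSets n)
  rest    = map (Vec._∷ʳ false) (produced (initChain n) is)
            ++ applyDownFrom ((Vec._∷ʳ true) ∘ c) n ++ map (Vec._∷ʳ true) (produced c is′)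

-- The second construction is a stepping sequence: its sets are, up to order,
-- the sets visited by is without n+1 and those visited by is′ from the flag
-- c with n+1.
stepping-down : ∀ n is is′ → IsStepping n is → IsStepping n is′ →
  IsStepping (suc n) (is ++ reverse (applyUpTo suc n) ++ map suc is′)
stepping-down n is is′ (valid , enum) (valid′ , enum′) rewrite reverse-applyUpTo suc n =
  valid-seq ,
  enumerates-↭ (↭-sym bag) (enumerates-tagged tagging false enum (flag-enumerates flag is′ enum′))
  where
  open Extension (suffixExtension n)

  c : Chain n
  c = run (initChain n) is
  flag : IsFlag c
  flag = flag-run (initChain-flag n) is valid

  valid-seq : All (ValidMove (suc n)) (is ++ applyDownFrom suc n ++ map suc is′)
  valid-seq = AllP.++⁺ (mapAll valid-weaken valid)
    (AllP.++⁺ (AllP.applyDownFrom⁺₁ suc n (λ i<n → s≤s z≤n , i<n)) (AllP.map⁺ (mapAll valid-suc valid′)))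

  initial first sweep second : List (Subset (suc n))
  initial = map (tag false) (initialSets n)
  first   = map (tag false) (produced (initChain n) is)
  sweep   = applyDownFrom (tag true ∘ c) n
  second  = map (tag true) (produced c is′)

  bag : allSets (suc n) (is ++ applyDownFrom suc n ++ map suc is′)
        ↭ map (tag false) (allSets n is) ++ map (tag true) (visited c is′)
  bag = begin
    allSets (suc n) (is ++ applyDownFrom suc n ++ map suc is′)
      ≡⟨ allSets-down n is is′ valid valid′ ⟩
    initial ++ (tag true (c n) ∷ first ++ sweep ++ second)
      ↭⟨ ++⁺ˡ initial (shift (tag true (c n)) first (sweep ++ second)) ⟨
    initial ++ (first ++ tag true (c n) ∷ sweep ++ second)
      ≡⟨ ++-assoc initial first (tag true (c n) ∷ sweep ++ second) ⟨
    (initial ++ first) ++ applyDownFrom (tag true ∘ c) (suc n) ++ second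
      ≡⟨ cong (_++ applyDownFrom (tag true ∘ c) (suc n) ++ second) (map-++ (tag false) (initialSets n) _) ⟨
    map (tag false) (allSets n is) ++ applyDownFrom (tag true ∘ c) (suc n) ++ second
      ↭⟨ ++⁺ˡ (map (tag false) (allSets n is)) (++⁺ʳ second (applyDownFrom↭applyUpTo (tag true ∘ c) (suc n))) ⟩
    map (tag false) (allSets n is) ++ applyUpTo (tag true ∘ c) (suc n) ++ second
      ≡⟨ cong (map (tag false) (allSets n is) ++_) (map-visited (tag true) c is′) ⟨
    map (tag false) (allSets n is) ++ map (tag true) (visited c is′) ∎
    where open PermutationReasoning

-- Theorem 2.1: for m = n + 1 ≥ 2 both gluings of two stepping sequences for
-- m - 1 are stepping sequences for m.
theorem2p1 : (m : ℕ) → 2 ≤ m → (is is′ : List ℕ)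
    → length is ≡ 2 ^ (m ∸ 1) ∸ m → length is′ ≡ 2 ^ (m ∸ 1) ∸ m
    → IsStepping (m ∸ 1) is → IsStepping (m ∸ 1) is′
    → IsStepping m (map suc is ++ applyUpTo suc (m ∸ 1) ++ is′)
      × IsStepping m (is ++ reverse (applyUpTo suc (m ∸ 1)) ++ map suc is′)
theorem2p1 (suc n) (s≤s _) is is′ _ _ stepping stepping′ =
  stepping-up n is is′ stepping stepping′ , stepping-down n is is′ stepping stepping′
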